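{- There exist process templates $A,B$ forming 1-conjunctive systems and an $\mathrm{LTL}\setminus\mathsf{X}$ formula $h(A,B_1)$ such that $(A,B)^{(1,1)}$ has an unconditionally-fair initializing run satisfying $h(A,B_1)$, but $(A,B)^{(1,2)}$ has no unconditionally-fair initializing run satisfying $h(A,B_1)$.
   Context: A process template is $U=(Q_U,\mathrm{init}_U,\Sigma_U,\delta_U)$ with finite state set $Q_U$ containing initial state $\mathrm{init}_U$, finite input alphabet $\Sigma_U$, and guarded transition relation $\delta_U \subseteq Q_U \times \Sigma_U \times \mathcal{P}(Q_A \cup Q_B) \times Q_U$. $Q_A,Q_B$ are disjoint, as are $\Sigma_A,\Sigma_B$. The system $(A,B)^{(1,n)}$ consists of one copy $A$ of template $A$ and $n$ copies $B_1,\dots,B_n$ of $B$ in interleaving composition, starting with all processes in their initial states. A local transition $(q,\sigma,g,q')$ of process $p$ is enabled in global state $s$ with global input $e$ if $s(p)=q$, $e(p)=\sigma$ and (conjunctive interpretation) every process $p'\neq p$ has $s(p')\in g$; $\mathrm{init}_A,\mathrm{init}_B$ belong to every guard. The system is 1-conjunctive if every guard is of the form $(Q_A\cup Q_B)\setminus\{q\}$ for some state $q$. Each global step moves exactly one process along an enabled local transition. A run is a maximal sequence of configurations $(s_t,e_t,p_t)$ from the initial state ($p_t$ the moving process; a $\bot$ configuration occurs exactly when all processes are disabled, ending the run), in which a process's input changes only when that process moves. A run is unconditionally-fair if every process moves infinitely often, and initializing if every process that moves infinitely often visits its initial state infinitely often. $h(A,B_1)$ is an LTL formula without next-time over propositions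 from $Q_A\cup\Sigma_A$ and from $Q_B\cup\Sigma_B$ indexed by $B_1$. -}

module Defs where

open import Data.Nat using (ℕ; zero; suc; _≤_; _<_)
open import Data.Fin using (Fin)
open import Data.Bool using (Bool; true; false)
open import Data.Sum using (_⊎_; inj₁; inj₂)
open import Data.Product using (Σ; _×_; _,_; ∃; ∃-syntax; proj₁; proj₂)
open import Data.Maybe using (Maybe; just; nothing)
open import Data.Empty using (⊥)
open import Data.Unit using (⊤)
import Data.Fin
open import Relation.Nullary using (¬_)
open import Relation.Binary.PropositionalEquality using (_≡_; _≢_)

-- Guards.  Q_A = Fin nQA, Q_B = Fin nQB, Q_A ∪ Q_B (disjoint) = Fin nQA ⊎ Fin nQB.
-- A guard is a subset of Q_A ∪ Q_B, given by its characteristic function.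

GState : ℕ → ℕ → Set
GState nQA nQB = Fin nQA ⊎ Fin nQB

Guard : ℕ → ℕ → Set
Guard nQA nQB = GState nQA nQB → Bool

_∈g_ : ∀ {nQA nQB} → GState nQA nQB → Guard nQA nQB → Set
x ∈g g = g x ≡ true

-- A process template U = (Q_U, init_U, Σ_U, δ_U) with Q_U = Fin nQ,
-- Σ_U = Fin nΣ and δ_U ⊆ Q_U × Σ_U × P(Q_A ∪ Q_B) × Q_U.

record Template (nQ nQA nQB : ℕ) : Set₁ where
  field
    nΣ   : ℕ
    init : Fin nQ
    δ    : Fin nQ → Fin nΣ → Guard nQA nQB → Fin nQ → Set
open Template public

-- A pair of templates A, B (with Q_A = Fin nQA, Q_B = Fin nQB) such that
-- init_A and init_B belong to every guard (standing assumption).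
record Templates (nQA nQB : ℕ) : Set₁ where
  field
    tA : Template nQA nQA nQB
    tB : Template nQB nQA nQB
    initA-in-guardsA : ∀ q σ g q' → δ tA q σ g q' → inj₁ (init tA) ∈g g
    initB-in-guardsA : ∀ q σ g q' → δ tA q σ g q' → inj₂ (init tB) ∈g g
    initA-in-guardsB : ∀ q σ g q' → δ tB q σ g q' → inj₁ (init tA) ∈g g
    initB-in-guardsB : ∀ q σ g q' → δ tB q σ g q' → inj₂ (init tB) ∈g g
open Templates public

IsOneConjGuard : ∀ {nQA nQB} → Guard nQA nQB → Set
IsOneConjGuard {nQA} {nQB} g =
  ∃[ q ] ∀ (x : GState nQA nQB) → (x ∈g g → x ≢ q) × (x ≢ q → x ∈g g)

OneConjunctive : ∀ {nQA nQB} → Templates nQA nQB → Set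
OneConjunctive T =
  (∀ q σ g q' → δ (tA T) q σ g q' → IsOneConjGuard g) ×
  (∀ q σ g q' → δ (tB T) q σ g q' → IsOneConjGuard g)

-- The system (A,B)^(1,n): process A and processes B_1..B_n (indexed by Fin n;
-- B_1 is index zero).

module System {nQA nQB : ℕ} (T : Templates nQA nQB) (n : ℕ) where

  ΣA = Fin (nΣ (tA T))
  ΣB = Fin (nΣ (tB T))

  data Proc : Set where
    pA : Proc
    pB : Fin n → Proc

  record GlobalState : Set where
    constructor gs
    field
      sA : Fin nQA
      sB : Fin n → Fin nQB
  open GlobalState public

  record Input : Set where
    constructor inp
    field
      eA : ΣA
      eB : Fin n → ΣB
  open Input public

  stateOf : GlobalState → Proc → GState nQA nQB
  stateOf s pA     = inj₁ (sA s)
  stateOf s (pB i) = inj₂ (sB s i)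

  initialState : GlobalState
  initialState = gs (init (tA T)) (λ _ → init (tB T))

  GuardOK : GlobalState → Proc → Guard nQA nQB → Set
  GuardOK s p g = ∀ p' → p' ≢ p → stateOf s p' ∈g g

  Step : GlobalState → Input → Proc → GlobalState → Set
  Step s e pA s' =
    Σ (Guard nQA nQB) λ g → Σ (Fin nQA) λ q' →
      δ (tA T) (sA s) (eA e) g q' × GuardOK s pA g ×
      (sA s' ≡ q') × (∀ j → sB s' j ≡ sB s j)
  Step s e (pB i) s' =
    Σ (Guard nQA nQB) λ g → Σ (Fin nQB) λ q' →
      δ (tB T) (sB s i) (eB e i) g q' × GuardOK s (pB i) g ×
      (sA s' ≡ sA s) × (sB s' i ≡ q') × (∀ j → j ≢ i → sB s' j ≡ sB s j)

  Enabled : GlobalState → Input → Proc → Set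
  Enabled s e p = ∃[ s' ] Step s e p s'

  SameInput : Input → Input → Proc → Set
  SameInput e e' pA     = eA e' ≡ eA e
  SameInput e e' (pB i) = eB e' i ≡ eB e i

  -- configuration (s, e, p); p = nothing is the ⊥ configuration
  record Config : Set where
    constructor cfg
    field
      st  : GlobalState
      inpt : Input
      mv  : Maybe Proc
  open Config public

  -- A run, as an infinite sequence of configurations.  Once a ⊥ configuration
  -- occurs the run has ended; we represent this by repeating it forever.
  record IsRun (ρ : ℕ → Config) : Set where
    field
      start   : st (ρ zero) ≡ initialState
      moveOK  : ∀ t p → mv (ρ t) ≡ just p →
                  Step (st (ρ t)) (inpt (ρ t)) p (st (ρ (suc t))) ×
                  (∀ p' → p' ≢ p → SameInput (inpt (ρ t)) (inpt (ρ (suc t))) p')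
      -- ⊥ occurs exactly when all processes are disabled (maximality)
      botOK   : ∀ t → mv (ρ t) ≡ nothing →
                  ∀ p → ¬ Enabled (st (ρ t)) (inpt (ρ t)) p
      botEnd  : ∀ t → mv (ρ t) ≡ nothing → ρ (suc t) ≡ ρ t

  MovesInfOften : (ℕ → Config) → Proc → Set
  MovesInfOften ρ p = ∀ t → ∃[ t' ] (t ≤ t' × mv (ρ t') ≡ just p)

  UnconditionallyFair : (ℕ → Config) → Set
  UnconditionallyFair ρ = ∀ p → MovesInfOften ρ p

  initOf : Proc → GState nQA nQB
  initOf pA     = inj₁ (init (tA T))
  initOf (pB _) = inj₂ (init (tB T))

  Initializing : (ℕ → Config) → Set
  Initializing ρ = ∀ p → MovesInfOften ρ p →
    ∀ t → ∃[ t' ] (t ≤ t' × stateOf (st (ρ t')) p ≡ initOf p)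

data LTLX (nQA nQB nΣA nΣB : ℕ) : Set where
  atQA  : Fin nQA → LTLX nQA nQB nΣA nΣB
  atΣA  : Fin nΣA → LTLX nQA nQB nΣA nΣB
  atQB1 : Fin nQB → LTLX nQA nQB nΣA nΣB
  atΣB1 : Fin nΣB → LTLX nQA nQB nΣA nΣB
  ltrue : LTLX nQA nQB nΣA nΣB
  ¬ₗ_   : LTLX nQA nQB nΣA nΣB → LTLX nQA nQB nΣA nΣB
  _∧ₗ_  : LTLX nQA nQB nΣA nΣB → LTLX nQA nQB nΣA nΣB → LTLX nQA nQB nΣA nΣB
  _Uₗ_  : LTLX nQA nQB nΣA nΣB → LTLX nQA nQB nΣA nΣB → LTLX nQA nQB nΣA nΣB

Formula : ∀ {nQA nQB} → Templates nQA nQB → Set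
Formula {nQA} {nQB} T = LTLX nQA nQB (nΣ (tA T)) (nΣ (tB T))

module Semantics {nQA nQB : ℕ} (T : Templates nQA nQB) (m : ℕ) where
  open System T (suc m)

  _,_⊨_ : (ℕ → Config) → ℕ → Formula T → Set
  ρ , t ⊨ atQA q  = sA (st (ρ t)) ≡ q
  ρ , t ⊨ atΣA σ  = eA (inpt (ρ t)) ≡ σ
  ρ , t ⊨ atQB1 q = sB (st (ρ t)) Data.Fin.zero ≡ q
  ρ , t ⊨ atΣB1 σ = eB (inpt (ρ t)) Data.Fin.zero ≡ σ
  ρ , t ⊨ ltrue    = ⊤
  ρ , t ⊨ (¬ₗ φ)   = ¬ (ρ , t ⊨ φ)
  ρ , t ⊨ (φ ∧ₗ ψ) = (ρ , t ⊨ φ) × (ρ , t ⊨ ψ)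
  ρ , t ⊨ (φ Uₗ ψ) = ∃[ k ] (t ≤ k × (ρ , k ⊨ ψ) × (∀ j → t ≤ j → j < k → ρ , j ⊨ φ))

  HasFairInitRun : Formula T → Set
  HasFairInitRun h = ∃[ ρ ] (IsRun ρ × UnconditionallyFair ρ × Initializing ρ × (ρ , 0 ⊨ h))

-- The formula h says that A and B₁ stay in (0,0) until, from some point on, they are never in
-- (0,0) again.  With a single B, the pair (A, B₁) runs around the cycle
-- (1,0) (1,1) (0,1) (0,2) (1,2) forever.  With two Bs, once (A, B₁) avoids (0,0), the first move
-- of B₂ out of its initial state puts (A, B₁, B₂) into a set of states that no step leaves
-- without passing through (A, B₁) = (0,0), and in all of them B₂ is busy; so B₂ never
-- re-initializes.
module Submission where

open import Defs
open import Data.Bool using (not)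
open import Data.Empty using (⊥; ⊥-elim)
open import Data.Fin using (Fin)
import Data.Fin.Properties as Fin
open import Data.Fin.Patterns using (0F; 1F; 2F)
open import Data.Maybe using (just; nothing)
open import Data.Nat using (ℕ; zero; suc; _+_; _*_; _≤_; z≤n; s≤s; _≤′_; ≤′-refl; ≤′-step)
open import Data.Nat.Properties
  using (≤-refl; ≤-trans; +-assoc; m≤m+n; m≤m*n; n≤1+n; ≤′⇒≤; ≤⇒≤′)
open import Data.Product using (Σ; _×_; _,_; proj₁; ∃-syntax)
open import Data.Sum using (_⊎_; inj₁; inj₂)
open import Data.Sum.Properties using (≡-dec; inj₂-injective)
open import Data.Unit using (tt)
open import Function using (_∘_)
open import Relation.Nullary using (¬_; Dec; yes; no; does)
open import Relation.Binary.PropositionalEquality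
  using (_≡_; _≢_; refl; sym; trans; cong; subst)

≤-induction : ∀ {p} (P : ℕ → Set p) {a} → P a → (∀ t → a ≤ t → P t → P (suc t)) →
              ∀ t → a ≤ t → P t
≤-induction P {a} base step t a≤t = go (≤⇒≤′ a≤t)
  where
  go : ∀ {t} → a ≤′ t → P t
  go ≤′-refl         = base
  go (≤′-step a≤′t) = step _ (≤′⇒≤ a≤′t) (go a≤′t)

periodic⇒recurrent : ∀ {a} {X : Set a} (f : ℕ → X) p → (∀ t → f (suc p + t) ≡ f t) →
                     ∀ u t → ∃[ t' ] (t ≤ t' × f t' ≡ f u)
periodic⇒recurrent f p periodic u t =
  t * suc p + u , ≤-trans (m≤m*n t (suc p)) (m≤m+n _ u) , after t
  where
  after : ∀ k → f (k * suc p + u) ≡ f u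
  after zero    = refl
  after (suc k) = trans (cong f (+-assoc (suc p) (k * suc p) u)) (trans (periodic _) (after k))

_≟ₛ_ : ∀ {nQA nQB} (x y : GState nQA nQB) → Dec (x ≡ y)
_≟ₛ_ = ≡-dec Fin._≟_ Fin._≟_

allBut : ∀ {nQA nQB} → GState nQA nQB → Guard nQA nQB
allBut q x = not (does (x ≟ₛ q))

allBut-isOneConj : ∀ {nQA nQB} (q : GState nQA nQB) → IsOneConjGuard (allBut q)
allBut-isOneConj q = q , membership
  where
  membership : ∀ x → (x ∈g allBut q → x ≢ q) × (x ≢ q → x ∈g allBut q)
  membership x with x ≟ₛ q
  ... | yes x≡q = (λ ()) , λ x≢q → ⊥-elim (x≢q x≡q)
  ... | no x≢q  = (λ _ → x≢q) , λ _ → refl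

module SingleB {nQA nQB} (T : Templates nQA nQB) where
  open System T 1

  A-step : ∀ {s g a'} e → δ (tA T) (sA s) (eA e) g a' → inj₂ (sB s 0F) ∈g g →
           Step s e pA (gs a' (sB s))
  A-step {s} {g} _ d ok = g , _ , d , guardOK , refl , λ _ → refl
    where
    guardOK : GuardOK s pA g
    guardOK pA      pA≢pA = ⊥-elim (pA≢pA refl)
    guardOK (pB 0F) _     = ok

  B-step : ∀ {s g b'} e → δ (tB T) (sB s 0F) (eB e 0F) g b' → inj₁ (sA s) ∈g g →
           Step s e (pB 0F) (gs (sA s) λ _ → b')
  B-step {s} {g} _ d ok = g , _ , d , guardOK , refl , refl , λ { 0F 0≢0 → ⊥-elim (0≢0 refl) }
    where
    guardOK : GuardOK s (pB 0F) g
    guardOK pA      _     = ok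
    guardOK (pB 0F) B≢B = ⊥-elim (B≢B refl)

module Runs {nQA nQB} (T : Templates nQA nQB) (n : ℕ) where
  open System T n

  Stable : (GlobalState → Set) → (GlobalState → Set) → Set
  Stable Q P = ∀ s e p s' → Step s e p s' → Q s' → P s → P s'

  stable-persists : ∀ {ρ} → IsRun ρ → ∀ {Q P} → Stable Q P →
                    ∀ {a} → (∀ t → a ≤ t → Q (st (ρ t))) → P (st (ρ a)) →
                    ∀ t → a ≤ t → P (st (ρ t))
  stable-persists {ρ} run {Q} {P} stable {a} Q-after Pa = ≤-induction (P ∘ st ∘ ρ) Pa advance
    where
    open IsRun run
    advance : ∀ t → a ≤ t → P (st (ρ t)) → P (st (ρ (suc t)))
    advance t a≤t Pt with mv (ρ t) in moved
    ... | nothing = subst (P ∘ st) (sym (botEnd t moved)) Pt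
    ... | just p  =
      stable _ _ p _ (proj₁ (moveOK t p moved)) (Q-after (suc t) (≤-trans a≤t (n≤1+n t))) Pt

◇ₗ_ : ∀ {nQA nQB nΣA nΣB} → LTLX nQA nQB nΣA nΣB → LTLX nQA nQB nΣA nΣB
◇ₗ φ = ltrue Uₗ φ

module _ {nQA nQB} {T : Templates nQA nQB} {m : ℕ} where
  open Semantics T m

  ¬◇-intro : ∀ {ρ k φ} → (∀ t → k ≤ t → ¬ ρ , t ⊨ φ) → ρ , k ⊨ (¬ₗ (◇ₗ φ))
  ¬◇-intro never (t , k≤t , φ-at-t , _) = never t k≤t φ-at-t

  ¬◇-elim : ∀ {ρ k φ} → ρ , k ⊨ (¬ₗ (◇ₗ φ)) → ∀ t → k ≤ t → ¬ ρ , t ⊨ φ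
  ¬◇-elim ¬◇φ t k≤t φ-at-t = ¬◇φ (t , k≤t , φ-at-t , λ _ _ _ → tt)

data δA : Fin 2 → Fin 1 → Guard 2 3 → Fin 2 → Set where
  a01 : ∀ {σ} → δA 0F σ (allBut (inj₁ 1F)) 1F
  a10 : ∀ {σ} → δA 1F σ (allBut (inj₂ 2F)) 0F

data δB : Fin 3 → Fin 1 → Guard 2 3 → Fin 3 → Set where
  b01 : ∀ {σ} → δB 0F σ (allBut (inj₂ 1F)) 1F
  b12 : ∀ {σ} → δB 1F σ (allBut (inj₁ 1F)) 2F
  b20 : ∀ {σ} → δB 2F σ (allBut (inj₂ 2F)) 0F

AB : Templates 2 3
AB = record
  { tA = record { nΣ = 1 ; init = 0F ; δ = δA }
  ; tB = record { nΣ = 1 ; init = 0F ; δ = δB }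
  ; initA-in-guardsA = λ { _ _ _ _ a01 → refl ; _ _ _ _ a10 → refl }
  ; initB-in-guardsA = λ { _ _ _ _ a01 → refl ; _ _ _ _ a10 → refl }
  ; initA-in-guardsB = λ { _ _ _ _ b01 → refl ; _ _ _ _ b12 → refl ; _ _ _ _ b20 → refl }
  ; initB-in-guardsB = λ { _ _ _ _ b01 → refl ; _ _ _ _ b12 → refl ; _ _ _ _ b20 → refl }
  }

AB-oneConjunctive : OneConjunctive AB
AB-oneConjunctive =
  (λ { _ _ _ _ a01 → allBut-isOneConj _ ; _ _ _ _ a10 → allBut-isOneConj _ }) ,
  (λ { _ _ _ _ b01 → allBut-isOneConj _ ; _ _ _ _ b12 → allBut-isOneConj _
     ; _ _ _ _ b20 → allBut-isOneConj _ })

atInitAB₁ : Formula AB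
atInitAB₁ = atQA 0F ∧ₗ atQB1 0F

h : Formula AB
h = atInitAB₁ Uₗ (¬ₗ (◇ₗ atInitAB₁))

module WithOneB where
  open System AB 1
  open Semantics AB 0
  open SingleB AB

  data Phase : Set where
    a₀b₀ a₁b₀ a₁b₁ a₀b₁ a₀b₂ a₁b₂ : Phase

  next : Phase → Phase
  next a₀b₀ = a₁b₀
  next a₁b₀ = a₁b₁
  next a₁b₁ = a₀b₁
  next a₀b₁ = a₀b₂
  next a₀b₂ = a₁b₂
  next a₁b₂ = a₁b₀

  stateAt : Phase → GlobalState
  stateAt a₀b₀ = gs 0F λ _ → 0F
  stateAt a₁b₀ = gs 1F λ _ → 0F
  stateAt a₁b₁ = gs 1F λ _ → 1F
  stateAt a₀b₁ = gs 0F λ _ → 1F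
  stateAt a₀b₂ = gs 0F λ _ → 2F
  stateAt a₁b₂ = gs 1F λ _ → 2F

  mover : Phase → Proc
  mover a₀b₀ = pA
  mover a₁b₀ = pB 0F
  mover a₁b₁ = pA
  mover a₀b₁ = pB 0F
  mover a₀b₂ = pA
  mover a₁b₂ = pB 0F

  input : Input
  input = inp 0F λ _ → 0F

  step-at : ∀ x → Step (stateAt x) input (mover x) (stateAt (next x))
  step-at a₀b₀ = A-step input a01 refl
  step-at a₁b₀ = B-step input b01 refl
  step-at a₁b₁ = A-step input a10 refl
  step-at a₀b₁ = B-step input b12 refl
  step-at a₀b₂ = A-step input a01 refl
  step-at a₁b₂ = B-step input b20 refl

  next-cycle : ∀ x → next (next (next (next (next (next x))))) ≡ next x
  next-cycle a₀b₀ = refl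
  next-cycle a₁b₀ = refl
  next-cycle a₁b₁ = refl
  next-cycle a₀b₁ = refl
  next-cycle a₀b₂ = refl
  next-cycle a₁b₂ = refl

  cycle-avoids-init : ∀ x → ¬ (sA (stateAt (next x)) ≡ 0F × sB (stateAt (next x)) 0F ≡ 0F)
  cycle-avoids-init a₀b₀ (() , _)
  cycle-avoids-init a₁b₀ (() , _)
  cycle-avoids-init a₁b₁ (_ , ())
  cycle-avoids-init a₀b₁ (_ , ())
  cycle-avoids-init a₀b₂ (() , _)
  cycle-avoids-init a₁b₂ (() , _)

  phase : ℕ → Phase
  phase zero    = a₀b₀
  phase (suc t) = next (phase t)

  phase-recurs : (P : Phase → Set) → ∀ u → P (phase (suc u)) →
                 ∀ t → ∃[ t' ] (t ≤ t' × P (phase t'))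
  phase-recurs P u P-at-u t with periodic⇒recurrent (phase ∘ suc) 4 (next-cycle ∘ phase) u t
  ... | t' , t≤t' , same = suc t' , ≤-trans t≤t' (n≤1+n t') , subst P (sym same) P-at-u

  ρ : ℕ → Config
  ρ t = cfg (stateAt (phase t)) input (just (mover (phase t)))

  same-input : ∀ p → SameInput input input p
  same-input pA     = refl
  same-input (pB _) = refl

  ρ-isRun : IsRun ρ
  ρ-isRun = record
    { start  = refl
    ; moveOK = λ { t _ refl → step-at (phase t) , λ p _ → same-input p }
    ; botOK  = λ _ ()
    ; botEnd = λ _ ()
    }

  ρ-fair : UnconditionallyFair ρ
  ρ-fair pA      = phase-recurs (λ x → just (mover x) ≡ just pA) 1 refl
  ρ-fair (pB 0F) = phase-recurs (λ x → just (mover x) ≡ just (pB 0F)) 0 refl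

  ρ-initializing : Initializing ρ
  ρ-initializing pA      _ = phase-recurs (λ x → stateOf (stateAt x) pA ≡ initOf pA) 2 refl
  ρ-initializing (pB 0F) _ = phase-recurs (λ x → stateOf (stateAt x) (pB 0F) ≡ initOf (pB 0F)) 0 refl

  ρ-satisfies-h : ρ , 0 ⊨ h
  ρ-satisfies-h =
    1 , z≤n ,
    ¬◇-intro {ρ = ρ} {φ = atInitAB₁} (λ { zero () ; (suc t) _ → cycle-avoids-init (phase t) }) ,
    λ { zero _ _ → refl , refl ; (suc _) _ (s≤s ()) }

  fair-init-run : HasFairInitRun h
  fair-init-run = ρ , ρ-isRun , ρ-fair , ρ-initializing , ρ-satisfies-h

-- States (A, B₁, B₂) from which B₂ cannot get back to 0 unless (A, B₁) first passes (0,0).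
data Trap : Fin 2 → Fin 3 → Fin 3 → Set where
  at101 : Trap 1F 0F 1F
  at∗21 : ∀ {a} → Trap a 2F 1F
  at∗22 : ∀ {a} → Trap a 2F 2F

Trap⇒B₂≢0 : ∀ {a b₁ b₂} → Trap a b₁ b₂ → b₂ ≢ 0F
Trap⇒B₂≢0 at101 ()
Trap⇒B₂≢0 at∗21 ()
Trap⇒B₂≢0 at∗22 ()

A-move-Trap : ∀ {a b₁ b₂ σ g a'} → δA a σ g a' → inj₂ b₁ ∈g g → inj₂ b₂ ∈g g →
              ¬ (a' ≡ 0F × b₁ ≡ 0F) → Trap a b₁ b₂ → Trap a' b₁ b₂
A-move-Trap a10 _  _ not-init at101 = ⊥-elim (not-init (refl , refl))
A-move-Trap a01 _  _ _        at∗21 = at∗21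
A-move-Trap a10 () _ _        at∗21
A-move-Trap a01 _  _ _        at∗22 = at∗22
A-move-Trap a10 () _ _        at∗22

B₁-move-Trap : ∀ {a b₁ b₂ σ g b₁'} → δB b₁ σ g b₁' → inj₁ a ∈g g → inj₂ b₂ ∈g g →
               ¬ (a ≡ 0F × b₁' ≡ 0F) → Trap a b₁ b₂ → Trap a b₁' b₂
B₁-move-Trap b01 _ ()        _ at101
B₁-move-Trap {a = 0F} b20 _ _ not-init at∗21 = ⊥-elim (not-init (refl , refl))
B₁-move-Trap {a = 1F} b20 _ _ _        at∗21 = at101
B₁-move-Trap b20 _ () _ at∗22

B₂-move-Trap : ∀ {a b₁ b₂ σ g b₂'} → δB b₂ σ g b₂' → inj₁ a ∈g g → inj₂ b₁ ∈g g →
               ¬ (a ≡ 0F × b₁ ≡ 0F) → b₂ ≡ 0F ⊎ Trap a b₁ b₂ → Trap a b₁ b₂'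
B₂-move-Trap {a = 0F} {0F} b01 _ _  not-init _ = ⊥-elim (not-init (refl , refl))
B₂-move-Trap {a = 1F} {0F} b01 _ _  _ _        = at101
B₂-move-Trap {b₁ = 1F}     b01 _ () _ _
B₂-move-Trap {b₁ = 2F}     b01 _ _  _ _        = at∗21
B₂-move-Trap               b12 () _ _ (inj₂ at101)
B₂-move-Trap {a = 0F}      b12 _ _  _ (inj₂ at∗21) = at∗22
B₂-move-Trap {a = 1F}      b12 () _ _ (inj₂ at∗21)
B₂-move-Trap               b20 _ () _ (inj₂ at∗22)

module WithTwoBs where
  open System AB 2
  open Semantics AB 1
  open Runs AB 2

  B₁ B₂ : Proc
  B₁ = pB 0F
  B₂ = pB 1F

  InitAB₁ : GlobalState → Set
  InitAB₁ s = sA s ≡ 0F × sB s 0F ≡ 0F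

  Trapped : GlobalState → Set
  Trapped s = Trap (sA s) (sB s 0F) (sB s 1F)

  Armed : GlobalState → Set
  Armed s = sB s 1F ≡ 0F ⊎ Trapped s

  trapped-at : ∀ s {a b₁ b₂} → sA s ≡ a → sB s 0F ≡ b₁ → sB s 1F ≡ b₂ → Trap a b₁ b₂ → Trapped s
  trapped-at _ refl refl refl trap = trap

  not-init-at : ∀ s {a b₁} → sA s ≡ a → sB s 0F ≡ b₁ → ¬ InitAB₁ s → ¬ (a ≡ 0F × b₁ ≡ 0F)
  not-init-at _ refl refl not-init = not-init

  B₂-step-springs : ∀ s e s' → Step s e B₂ s' → ¬ InitAB₁ s' → Armed s → Trapped s'
  B₂-step-springs _ _ s' (_ , _ , d , guardOK , a≡ , b₂≡ , others) not-init armed =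
    trapped-at s' a≡ b₁≡ b₂≡
      (B₂-move-Trap d (guardOK pA λ ()) (guardOK B₁ λ ()) (not-init-at s' a≡ b₁≡ not-init) armed)
    where b₁≡ = others 0F λ ()

  Trapped-stable : Stable (¬_ ∘ InitAB₁) Trapped
  Trapped-stable _ _ pA s' (_ , _ , d , guardOK , a≡ , same) not-init trap =
    trapped-at s' a≡ (same 0F) (same 1F)
      (A-move-Trap d (guardOK B₁ λ ()) (guardOK B₂ λ ()) (not-init-at s' a≡ (same 0F) not-init) trap)
  Trapped-stable _ _ (pB 0F) s' (_ , _ , d , guardOK , a≡ , b₁≡ , others) not-init trap =
    trapped-at s' a≡ b₁≡ (others 1F λ ())
      (B₁-move-Trap d (guardOK pA λ ()) (guardOK B₂ λ ()) (not-init-at s' a≡ b₁≡ not-init) trap)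
  Trapped-stable s e (pB 1F) s' step not-init trap = B₂-step-springs s e s' step not-init (inj₂ trap)

  Armed-stable : Stable (¬_ ∘ InitAB₁) Armed
  Armed-stable s e (pB 1F) s' step not-init armed = inj₂ (B₂-step-springs s e s' step not-init armed)
  Armed-stable s e p s' step not-init (inj₂ trap) = inj₂ (Trapped-stable s e p s' step not-init trap)
  Armed-stable _ _ pA _ (_ , _ , _ , _ , _ , same) _ (inj₁ b₂≡0) = inj₁ (trans (same 1F) b₂≡0)
  Armed-stable _ _ (pB 0F) _ (_ , _ , _ , _ , _ , _ , others) _ (inj₁ b₂≡0) =
    inj₁ (trans (others 1F λ ()) b₂≡0)

  module _ {ρ} (run : IsRun ρ) (fair : UnconditionallyFair ρ) (initializing : Initializing ρ)
           {k} (avoids-init : ∀ t → k ≤ t → ¬ InitAB₁ (st (ρ t))) where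
    open IsRun run

    B₂-returns : ∀ t → ∃[ t' ] (t ≤ t' × sB (st (ρ t')) 1F ≡ 0F)
    B₂-returns t with initializing B₂ (fair B₂) t
    ... | t' , t≤t' , at-init = t' , t≤t' , inj₂-injective at-init

    armed-from : ∀ {a} → k ≤ a → sB (st (ρ a)) 1F ≡ 0F → ∀ t → a ≤ t → Armed (st (ρ t))
    armed-from k≤a idle =
      stable-persists run Armed-stable (λ t a≤t → avoids-init t (≤-trans k≤a a≤t)) (inj₁ idle)

    trapped-after : ∀ {a} → k ≤ a → mv (ρ a) ≡ just B₂ → Armed (st (ρ a)) →
                    ∀ t → suc a ≤ t → Trapped (st (ρ t))
    trapped-after {a} k≤a B₂-moves armed =
      stable-persists run Trapped-stable (λ t a<t → avoids-init t (k≤ a<t))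
        (B₂-step-springs (st (ρ a)) (inpt (ρ a)) (st (ρ (suc a)))
          (proj₁ (moveOK a B₂ B₂-moves)) (avoids-init (suc a) (k≤ ≤-refl)) armed)
      where
      k≤ : ∀ {t} → suc a ≤ t → k ≤ t
      k≤ a<t = ≤-trans k≤a (≤-trans (n≤1+n a) a<t)

    contradiction : ⊥
    contradiction with B₂-returns k
    ... | t₁ , k≤t₁ , idle₁ with fair B₂ t₁
    ... | t₂ , t₁≤t₂ , B₂-moves with B₂-returns (suc t₂)
    ... | t₃ , t₂<t₃ , idle₃ =
      Trap⇒B₂≢0 (trapped-after (≤-trans k≤t₁ t₁≤t₂) B₂-moves (armed-from k≤t₁ idle₁ t₂ t₁≤t₂) t₃ t₂<t₃)
                idle₃

  no-fair-init-run : ¬ HasFairInitRun h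
  no-fair-init-run (ρ , run , fair , initializing , (k , _ , never-init , _)) =
    contradiction run fair initializing (¬◇-elim {ρ = ρ} {φ = atInitAB₁} never-init)

mainTheorem16 : ∃[ nQA ] ∃[ nQB ] Σ (Templates nQA nQB) λ T →
                  OneConjunctive T × Σ (Formula T) λ h →
                    Semantics.HasFairInitRun T 0 h × ¬ Semantics.HasFairInitRun T 1 h
mainTheorem16 =
  2 , 3 , AB , AB-oneConjunctive , h , WithOneB.fair-init-run , WithTwoBs.no-fair-init-run
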